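{- For every linear ordering $\alpha$ and every natural number $k\ge1$, there exists a map $c\colon\alpha\to\{0,\dots,k-1\}$ such that for all $x<y$ in $\alpha$ with $c(x)=c(y)$, one has $c([x,y])=\{0,\dots,k-1\}$. -}

module Defs where

open import Level using (0ℓ)
open import Data.Product using (Σ; ∃; _×_)
open import Data.Sum using (_⊎_)
open import Data.Fin using (Fin)
open import Data.Nat using (ℕ)
open import Relation.Nullary using (Dec)
open import Relation.Binary.Core using (Rel)
open import Relation.Binary.Structures using (IsStrictTotalOrder)
open import Relation.Binary.PropositionalEquality using (_≡_)
open import Induction.WellFounded using (WellFounded)

-- The paper works in ZFC.  Agda is constructive, so the two classical
-- principles of ZFC that the argument relies on are made explicit:
-- the law of excluded middle and the well-ordering theorem (≡ AC).
ExcludedMiddle : Set₁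
ExcludedMiddle = (P : Set) → Dec P

WellOrderingTheorem : Set₁
WellOrderingTheorem =
  (A : Set) → Σ (Rel A 0ℓ) λ _≺_ → IsStrictTotalOrder _≡_ _≺_ × WellFounded _≺_

Classical : Set₁
Classical = ExcludedMiddle × WellOrderingTheorem

Le : {α : Set} → Rel α 0ℓ → Rel α 0ℓ
Le _<_ x y = (x < y) ⊎ (x ≡ y)

AllColoursIn : {α : Set} (_<_ : Rel α 0ℓ) {k : ℕ} (c : α → Fin k) (x y : α) → Set
AllColoursIn _<_ {k} c x y = (j : Fin k) → ∃ λ z → Le _<_ x z × Le _<_ z y × c z ≡ j

-- Two points are close if one is reached from the other by finitely many
-- immediate-successor steps; the closeness classes (blocks) are intervals.
-- Fix a well-order ≺ of α.  Each point gets a label in ℕ, and its colour is the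
-- label modulo k.  Labels within a block are counted, up and down modulo k,
-- from its ≺-least point b, the leader; b itself is labelled 1 + the label of
-- its anchor, the ⊏-greatest point below b that ≺-precedes b (0 if none).
-- So immediate successors have consecutive labels modulo k.
--
-- Let x ⊏ y have equal colours.  If x and y are close, they are at least k
-- steps apart, and the steps between them pass through every residue.
-- Otherwise either the block of x or that of y contributes k consecutive points
-- to [x, y], or there is a gap (M, N) between them with M without successor
-- and N without predecessor.  Walk through the gap by repeatedly taking the
-- ≺-least point of (m, N): the next point m′ is either a leader with anchor m,
-- so its label is one more, or its leader lies at or below m, so m and m′ are
-- close and all labels in between are attained.  After k − 1 steps every
-- colour has been seen.
module Submission where

open import Defs
open import Level using (0ℓ)
open import Data.Nat using (ℕ; zero; suc; _+_; _*_; _∸_; _≤_; _<_; z≤n; s≤s; NonZero; _≤?_; _<?_)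
import Data.Nat.Properties as ℕ
open import Data.Nat.DivMod using (_%_; %-distribˡ-+; m%n%n≡m%n; [m+n]%n≡m%n; m<n⇒m%n≡m; m%n<n; m≤n⇒[n∸m]%m≡n%m)
open import Data.Fin using (Fin; toℕ; fromℕ<)
import Data.Fin.Properties as Fin
open import Data.Product using (Σ; ∃; ∃-syntax; _×_; _,_; proj₁; proj₂)
open import Data.Sum using (_⊎_; inj₁; inj₂)
open import Data.Empty using (⊥; ⊥-elim)
open import Relation.Nullary using (yes; no; ¬_)
open import Relation.Binary.Core using (Rel)
open import Relation.Binary.Bundles using (Setoid)
import Relation.Binary.Reasoning.Setoid as SetoidReasoning
open import Relation.Binary.Definitions using (tri<; tri≈; tri>)
open import Relation.Binary.Structures using (IsStrictTotalOrder)
open import Relation.Binary.PropositionalEquality using (_≡_; refl; sym; trans; cong; cong₂; subst; module ≡-Reasoning)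
open import Induction.WellFounded using (WellFounded; Acc; acc)

module Residues (K : ℕ) .{{_ : NonZero K}} where

  infix 4 _≡ₘ_
  record _≡ₘ_ (a b : ℕ) : Set where
    constructor mod
    field residues : a % K ≡ b % K
  open _≡ₘ_ public

  ≡ₘ-setoid : Setoid 0ℓ 0ℓ
  ≡ₘ-setoid = record
    { Carrier = ℕ
    ; _≈_ = _≡ₘ_
    ; isEquivalence = record
      { refl = mod refl
      ; sym = λ a≡b → mod (sym (residues a≡b))
      ; trans = λ a≡b b≡c → mod (trans (residues a≡b) (residues b≡c))
      }
    }

  open Setoid ≡ₘ-setoid public using () renaming (refl to ≡ₘ-refl; sym to ≡ₘ-sym; trans to ≡ₘ-trans)
  module ≡ₘ-Reasoning = SetoidReasoning ≡ₘ-setoid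

  ≡⇒≡ₘ : ∀ {a b} → a ≡ b → a ≡ₘ b
  ≡⇒≡ₘ a≡b = mod (cong (_% K) a≡b)

  %-≡ₘ : ∀ r → r % K ≡ₘ r
  %-≡ₘ r = mod (m%n%n≡m%n r K)

  +-cong-≡ₘ : ∀ {a b c d} → a ≡ₘ b → c ≡ₘ d → a + c ≡ₘ b + d
  +-cong-≡ₘ {a} {b} {c} {d} (mod a≡b) (mod c≡d) = mod (begin
    (a + c) % K          ≡⟨ %-distribˡ-+ a c K ⟩
    (a % K + c % K) % K  ≡⟨ cong₂ (λ u v → (u + v) % K) a≡b c≡d ⟩
    (b % K + d % K) % K  ≡⟨ %-distribˡ-+ b d K ⟨
    (b + d) % K          ∎)
    where open ≡-Reasoning

  residue-reachable : ∀ r j → j < K → ∃[ t ] t < K × (r + t) % K ≡ j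
  residue-reachable r j j<K = t , m%n<n _ K , (begin
    (r + t) % K              ≡⟨ residues (+-cong-≡ₘ (≡ₘ-sym (%-≡ₘ r)) (%-≡ₘ _)) ⟩
    (s + (K ∸ s + j)) % K    ≡⟨ cong (_% K) (ℕ.+-assoc s (K ∸ s) j) ⟨
    (s + (K ∸ s) + j) % K    ≡⟨ cong (λ u → (u + j) % K) (ℕ.m+[n∸m]≡n (ℕ.<⇒≤ (m%n<n r K))) ⟩
    (K + j) % K              ≡⟨ cong (_% K) (ℕ.+-comm K j) ⟩
    (j + K) % K              ≡⟨ [m+n]%n≡m%n j K ⟩
    j % K                    ≡⟨ m<n⇒m%n≡m j<K ⟩
    j                        ∎)
    where
      open ≡-Reasoning
      s = r % K
      t = (K ∸ s + j) % K

  r+n≡ₘr⇒n≡0 : ∀ r {n} → n < K → r + n ≡ₘ r → n ≡ 0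
  r+n≡ₘr⇒n≡0 r {zero} _ _ = refl
  r+n≡ₘr⇒n≡0 r {suc n} n<K r+n≡r =
    ⊥-elim (no-wrap (m%n<n r K) (residues (≡ₘ-trans (+-cong-≡ₘ (%-≡ₘ r) ≡ₘ-refl) r+n≡r)))
    where
      no-wrap : ∀ {s} → s < K → (s + suc n) % K ≡ s → ⊥
      no-wrap {s} s<K s+n%K≡s with s + suc n <? K
      ... | yes lt = ℕ.m+1+n≢m s (trans (sym (m<n⇒m%n≡m lt)) s+n%K≡s)
      ... | no ge = ℕ.<-irrefl (sym K≡1+n) n<K
        where
          K≤s+n : K ≤ s + suc n
          K≤s+n = ℕ.≮⇒≥ ge
          wrapped : s + suc n ∸ K ≡ s
          wrapped = trans (sym (m<n⇒m%n≡m (ℕ.m<n+o⇒m∸n<o _ K (ℕ.+-mono-< s<K n<K))))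
                          (trans (m≤n⇒[n∸m]%m≡n%m K≤s+n) s+n%K≡s)
          K≡1+n : K ≡ suc n
          K≡1+n = ℕ.+-cancelˡ-≡ s K (suc n)
                    (trans (cong (_+ K) (sym wrapped)) (ℕ.m∸n+n≡m K≤s+n))

module Successors {α : Set} {_⊏_ : Rel α 0ℓ} (sto : IsStrictTotalOrder _≡_ _⊏_) where

  open IsStrictTotalOrder sto public using (compare) renaming (trans to ⊏-trans; asym to ⊏-asym)

  infix 4 _⊑_ _⋖_

  _⊑_ : Rel α 0ℓ
  _⊑_ = Le _⊏_

  ⊏-irrefl : ∀ {x} → ¬ x ⊏ x
  ⊏-irrefl x⊏x = ⊏-asym x⊏x x⊏x

  ⊑-refl : ∀ {x} → x ⊑ x
  ⊑-refl = inj₂ refl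

  ⊑-⊏-trans : ∀ {x y z} → x ⊑ y → y ⊏ z → x ⊏ z
  ⊑-⊏-trans (inj₁ x⊏y) y⊏z = ⊏-trans x⊏y y⊏z
  ⊑-⊏-trans (inj₂ refl) y⊏z = y⊏z

  ⊏-⊑-trans : ∀ {x y z} → x ⊏ y → y ⊑ z → x ⊏ z
  ⊏-⊑-trans x⊏y (inj₁ y⊏z) = ⊏-trans x⊏y y⊏z
  ⊏-⊑-trans x⊏y (inj₂ refl) = x⊏y

  ⊑-trans : ∀ {x y z} → x ⊑ y → y ⊑ z → x ⊑ z
  ⊑-trans (inj₁ x⊏y) y⊑z = inj₁ (⊏-⊑-trans x⊏y y⊑z)
  ⊑-trans (inj₂ refl) y⊑z = y⊑z

  ⊑-antisym : ∀ {x y} → x ⊑ y → y ⊑ x → x ≡ y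
  ⊑-antisym (inj₂ x≡y) _ = x≡y
  ⊑-antisym (inj₁ _) (inj₂ y≡x) = sym y≡x
  ⊑-antisym (inj₁ x⊏y) (inj₁ y⊏x) = ⊥-elim (⊏-asym x⊏y y⊏x)

  ⊑⇒¬⊐ : ∀ {x y} → x ⊑ y → ¬ y ⊏ x
  ⊑⇒¬⊐ x⊑y y⊏x = ⊏-irrefl (⊑-⊏-trans x⊑y y⊏x)

  ¬⊐⇒⊑ : ∀ {x y} → ¬ y ⊏ x → x ⊑ y
  ¬⊐⇒⊑ {x} {y} ¬y⊏x with compare x y
  ... | tri< x⊏y _ _ = inj₁ x⊏y
  ... | tri≈ _ x≡y _ = inj₂ x≡y
  ... | tri> _ _ y⊏x = ⊥-elim (¬y⊏x y⊏x)

  _⋖_ : Rel α 0ℓ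
  x ⋖ y = x ⊏ y × (∀ z → x ⊏ z → ¬ z ⊏ y)

  ⋖-functional : ∀ {x y z} → x ⋖ y → x ⋖ z → y ≡ z
  ⋖-functional {y = y} {z} (x⊏y , y-next) (x⊏z , z-next) with compare y z
  ... | tri< y⊏z _ _ = ⊥-elim (z-next y x⊏y y⊏z)
  ... | tri≈ _ y≡z _ = y≡z
  ... | tri> _ _ z⊏y = ⊥-elim (y-next z x⊏z z⊏y)

  ⋖-injective : ∀ {x y z} → y ⋖ x → z ⋖ x → y ≡ z
  ⋖-injective {y = y} {z} (y⊏x , y-next) (z⊏x , z-next) with compare y z
  ... | tri< y⊏z _ _ = ⊥-elim (y-next z y⊏z z⊏x)
  ... | tri≈ _ y≡z _ = y≡z
  ... | tri> _ _ z⊏y = ⊥-elim (z-next y z⊏y y⊏x)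

  Dist : ℕ → Rel α 0ℓ
  Dist zero x y = x ≡ y
  Dist (suc n) x y = ∃[ w ] x ⋖ w × Dist n w y

  Dist⇒⊏ : ∀ n {x y} → Dist (suc n) x y → x ⊏ y
  Dist⇒⊏ zero (_ , x⋖y , refl) = proj₁ x⋖y
  Dist⇒⊏ (suc n) (_ , x⋖w , w→y) = ⊏-trans (proj₁ x⋖w) (Dist⇒⊏ n w→y)

  Dist⇒⊑ : ∀ {n x y} → Dist n x y → x ⊑ y
  Dist⇒⊑ {zero} x≡y = inj₂ x≡y
  Dist⇒⊑ {suc n} x→y = inj₁ (Dist⇒⊏ n x→y)

  Dist-snoc : ∀ n {x w y} → Dist n x w → w ⋖ y → Dist (suc n) x y
  Dist-snoc zero refl w⋖y = _ , w⋖y , refl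
  Dist-snoc (suc n) (v , x⋖v , v→w) w⋖y = v , x⋖v , Dist-snoc n v→w w⋖y

  Dist-unsnoc : ∀ n {x y} → Dist (suc n) x y → ∃[ p ] Dist n x p × p ⋖ y
  Dist-unsnoc zero (_ , x⋖y , refl) = _ , refl , x⋖y
  Dist-unsnoc (suc n) (w , x⋖w , w→y) with Dist-unsnoc n w→y
  ... | p , w→p , p⋖y = p , (w , x⋖w , w→p) , p⋖y

  Dist-trans : ∀ m n {x y z} → Dist m x y → Dist n y z → Dist (m + n) x z
  Dist-trans zero n refl y→z = y→z
  Dist-trans (suc m) n (w , x⋖w , w→y) y→z = w , x⋖w , Dist-trans m n w→y y→z

  Dist-prefix : ∀ {n t x y} → t ≤ n → Dist n x y → ∃[ w ] Dist t x w × w ⊑ y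
  Dist-prefix {t = zero} _ x→y = _ , refl , Dist⇒⊑ x→y
  Dist-prefix {suc n} {suc t} (s≤s t≤n) (v , x⋖v , v→y) with Dist-prefix t≤n v→y
  ... | w , v→w , w⊑y = w , (v , x⋖v , v→w) , w⊑y

  Dist-deterministic : ∀ m n {x y} → Dist m x y → Dist n x y → m ≡ n
  Dist-deterministic zero zero _ _ = refl
  Dist-deterministic zero (suc n) refl x→x = ⊥-elim (⊏-irrefl (Dist⇒⊏ n x→x))
  Dist-deterministic (suc m) zero x→x refl = ⊥-elim (⊏-irrefl (Dist⇒⊏ m x→x))
  Dist-deterministic (suc m) (suc n) (w , x⋖w , w→y) (w′ , x⋖w′ , w′→y)
    with ⋖-functional x⋖w x⋖w′
  ... | refl = cong suc (Dist-deterministic m n w→y w′→y)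

  Dist-antisym : ∀ m n {x y} → Dist m x y → Dist n y x → m ≡ 0 × n ≡ 0
  Dist-antisym zero zero _ _ = refl , refl
  Dist-antisym zero (suc n) refl x→x = ⊥-elim (⊏-irrefl (Dist⇒⊏ n x→x))
  Dist-antisym (suc m) n x→y y→x = ⊥-elim (⊑⇒¬⊐ (Dist⇒⊑ y→x) (Dist⇒⊏ m x→y))

  Dist-⊏⇒predecessor : ∀ {n x y} → Dist n x y → x ⊏ y → ∃[ p ] p ⋖ y
  Dist-⊏⇒predecessor {zero} refl x⊏x = ⊥-elim (⊏-irrefl x⊏x)
  Dist-⊏⇒predecessor {suc n} x→y _ with Dist-unsnoc n x→y
  ... | p , _ , p⋖y = p , p⋖y

  Dist-⊏⇒pos : ∀ {n x y} → Dist n x y → x ⊏ y → 0 < n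
  Dist-⊏⇒pos {zero} refl x⊏x = ⊥-elim (⊏-irrefl x⊏x)
  Dist-⊏⇒pos {suc n} _ _ = s≤s z≤n

  Dist-convex : ∀ n {x y z} → Dist n x y → x ⊑ z → z ⊑ y →
                ∃ (λ i → Dist i x z) × ∃ (λ j → Dist j z y)
  Dist-convex zero refl x⊑z z⊑x with ⊑-antisym x⊑z z⊑x
  ... | refl = (0 , refl) , (0 , refl)
  Dist-convex (suc n) x→y (inj₂ refl) _ = (0 , refl) , (suc n , x→y)
  Dist-convex (suc n) {z = z} (w , x⋖w , w→y) (inj₁ x⊏z) z⊑y with compare z w
  ... | tri< z⊏w _ _ = ⊥-elim (proj₂ x⋖w z x⊏z z⊏w)
  ... | tri≈ _ refl _ = (1 , w , x⋖w , refl) , (n , w→y)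
  ... | tri> _ _ w⊏z with Dist-convex n w→y (inj₁ w⊏z) z⊑y
  ...   | (i , w→z) , z→y = (suc i , w , x⋖w , w→z) , z→y

  infix 4 _∼_
  _∼_ : Rel α 0ℓ
  x ∼ y = ∃ (λ n → Dist n x y) ⊎ ∃ (λ n → Dist n y x)

  ∼-refl : ∀ {x} → x ∼ x
  ∼-refl = inj₁ (0 , refl)

  ∼-stepʳ : ∀ {x y y′} → y ⋖ y′ → x ∼ y → x ∼ y′
  ∼-stepʳ y⋖y′ (inj₁ (n , x→y)) = inj₁ (suc n , Dist-snoc n x→y y⋖y′)
  ∼-stepʳ y⋖y′ (inj₂ (zero , refl)) = inj₁ (1 , _ , y⋖y′ , refl)
  ∼-stepʳ y⋖y′ (inj₂ (suc n , v , y⋖v , v→x)) with ⋖-functional y⋖v y⋖y′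
  ... | refl = inj₂ (n , v→x)

  ∼-unstepʳ : ∀ {x y y′} → y ⋖ y′ → x ∼ y′ → x ∼ y
  ∼-unstepʳ y⋖y′ (inj₁ (zero , refl)) = inj₂ (1 , _ , y⋖y′ , refl)
  ∼-unstepʳ y⋖y′ (inj₁ (suc n , x→y′)) with Dist-unsnoc n x→y′
  ... | p , x→p , p⋖y′ with ⋖-injective p⋖y′ y⋖y′
  ...   | refl = inj₁ (n , x→p)
  ∼-unstepʳ y⋖y′ (inj₂ (n , y′→x)) = inj₂ (suc n , _ , y⋖y′ , y′→x)

module Minima (em : ExcludedMiddle) {α : Set} {_≺_ : Rel α 0ℓ}
              (wsto : IsStrictTotalOrder _≡_ _≺_) (wf : WellFounded _≺_) where

  open IsStrictTotalOrder wsto using (compare)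

  Least : (α → Set) → α → Set
  Least P m = P m × (∀ z → P z → ¬ z ≺ m)

  least : ∀ {P : α → Set} {a} → P a → ∃ (Least P)
  least {P} {a} = go a (wf a)
    where
      go : ∀ a → Acc _≺_ a → P a → ∃ (Least P)
      go a (acc rs) pa with em (∃[ z ] P z × z ≺ a)
      ... | yes (z , pz , z≺a) = go z (rs z≺a) pz
      ... | no ∄z = a , pa , λ z pz z≺a → ∄z (z , pz , z≺a)

  Least-unique : ∀ {P Q m n} → Least P m → Least Q n → P n → Q m → m ≡ n
  Least-unique {m = m} {n} (_ , m-least) (_ , n-least) pn qm with compare m n
  ... | tri< m≺n _ _ = ⊥-elim (n-least m qm m≺n)
  ... | tri≈ _ m≡n _ = m≡n
  ... | tri> _ _ n≺m = ⊥-elim (m-least n pn n≺m)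

  Least-⪯ : ∀ {P m} → Least P m → ∀ {z} → P z → Le _≺_ m z
  Least-⪯ {m = m} (_ , m-least) {z} pz with compare m z
  ... | tri< m≺z _ _ = inj₁ m≺z
  ... | tri≈ _ m≡z _ = inj₂ m≡z
  ... | tri> _ _ z≺m = ⊥-elim (m-least z pz z≺m)

module Colouring (em : ExcludedMiddle) {α : Set} {_⊏_ : Rel α 0ℓ} (sto : IsStrictTotalOrder _≡_ _⊏_)
                 {_≺_ : Rel α 0ℓ} (wsto : IsStrictTotalOrder _≡_ _≺_) (wf : WellFounded _≺_)
                 (k′ : ℕ) where

  open Successors sto
  open Minima em wsto wf
  open IsStrictTotalOrder wsto using () renaming (compare to ≺-compare; trans to ≺-trans)

  K : ℕ
  K = suc k′

  open Residues K

  leader : α → α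
  leader a = proj₁ (least {P = _∼ a} ∼-refl)

  leader-least : ∀ a → Least (_∼ a) (leader a)
  leader-least a = proj₂ (least {P = _∼ a} ∼-refl)

  leader-∼ : ∀ a → leader a ∼ a
  leader-∼ a = proj₁ (leader-least a)

  leader-⪯ : ∀ a → Le _≺_ (leader a) a
  leader-⪯ a = Least-⪯ (leader-least a) ∼-refl

  leader-≺ : ∀ {a b} → a ≺ b → leader a ≺ b
  leader-≺ {a} a≺b with leader-⪯ a
  ... | inj₁ leader≺a = ≺-trans leader≺a a≺b
  ... | inj₂ leader≡a = subst (_≺ _) (sym leader≡a) a≺b

  leader-⋖ : ∀ {x y} → x ⋖ y → leader y ≡ leader x
  leader-⋖ {x} {y} x⋖y = Least-unique (leader-least y) (leader-least x)
    (∼-stepʳ x⋖y (leader-∼ x)) (∼-unstepʳ x⋖y (leader-∼ y))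

  -- A point n steps below b gets offset n * k′, which is −n modulo K.
  offset : ∀ {b a} → b ∼ a → ℕ
  offset (inj₁ (n , _)) = n
  offset (inj₂ (n , _)) = n * k′

  offset-irrelevant : ∀ {b a} (p q : b ∼ a) → offset p ≡ offset q
  offset-irrelevant (inj₁ (m , b→a)) (inj₁ (n , b→a′)) = Dist-deterministic m n b→a b→a′
  offset-irrelevant (inj₂ (m , a→b)) (inj₂ (n , a→b′)) = cong (_* k′) (Dist-deterministic m n a→b a→b′)
  offset-irrelevant (inj₁ (m , b→a)) (inj₂ (n , a→b)) with Dist-antisym m n b→a a→b
  ... | refl , refl = refl
  offset-irrelevant (inj₂ (m , a→b)) (inj₁ (n , b→a)) with Dist-antisym m n a→b b→a
  ... | refl , refl = refl

  offset-stepʳ : ∀ {b a a′} (a⋖a′ : a ⋖ a′) (p : b ∼ a) →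
                 offset (∼-stepʳ a⋖a′ p) ≡ₘ suc (offset p)
  offset-stepʳ a⋖a′ (inj₁ _) = ≡ₘ-refl
  offset-stepʳ a⋖a′ (inj₂ (zero , refl)) = ≡ₘ-refl
  offset-stepʳ a⋖a′ (inj₂ (suc n , v , a⋖v , v→b)) with ⋖-functional a⋖v a⋖a′
  ... | refl = mod (trans (sym ([m+n]%n≡m%n (n * k′) K)) (cong (_% K) (ℕ.+-comm (n * k′) K)))

  Anchor : α → α → Set
  Anchor b p = p ⊏ b × p ≺ b × (∀ w → w ⊏ b → w ≺ b → ¬ p ⊏ w)

  anchor-unique : ∀ {b p q} → Anchor b p → Anchor b q → p ≡ q
  anchor-unique {p = p} {q} (p⊏b , p≺b , p-max) (q⊏b , q≺b , q-max) with compare p q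
  ... | tri< p⊏q _ _ = ⊥-elim (p-max q q⊏b q≺b p⊏q)
  ... | tri≈ _ p≡q _ = p≡q
  ... | tri> _ _ q⊏p = ⊥-elim (q-max p p⊏b p≺b q⊏p)

  base′ : ∀ b → Acc _≺_ b → ℕ
  base′ b (acc rs) with em (∃ (Anchor b))
  ... | yes (p , _ , p≺b , _) = suc (base′ (leader p) (rs (leader-≺ p≺b)) + offset (leader-∼ p))
  ... | no _ = 0

  base : α → ℕ
  base b = base′ b (wf b)

  label : α → ℕ
  label a = base (leader a) + offset (leader-∼ a)

  colour : α → Fin K
  colour a = fromℕ< (m%n<n (label a) K)

  base′-irrelevant : ∀ b (ac ac′ : Acc _≺_ b) → base′ b ac ≡ base′ b ac′
  base′-irrelevant b (acc rs) (acc rs′) with em (∃ (Anchor b))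
  ... | yes (p , _ , p≺b , _) =
        cong (λ n → suc (n + offset (leader-∼ p)))
             (base′-irrelevant (leader p) (rs (leader-≺ p≺b)) (rs′ (leader-≺ p≺b)))
  ... | no _ = refl

  base′-anchor : ∀ {b p} (ac : Acc _≺_ b) → Anchor b p → base′ b ac ≡ suc (label p)
  base′-anchor {b} (acc rs) bp with em (∃ (Anchor b))
  ... | yes (q , bq@(_ , q≺b , _)) with anchor-unique bq bp
  ...   | refl = cong (λ n → suc (n + offset (leader-∼ q)))
                      (base′-irrelevant (leader q) (rs (leader-≺ q≺b)) (wf (leader q)))
  base′-anchor (acc rs) bp | no ∄ = ⊥-elim (∄ (_ , bp))

  label-via : ∀ {a b} (p : b ∼ a) → leader a ≡ b → label a ≡ base b + offset p
  label-via p refl = cong (base _ +_) (offset-irrelevant (leader-∼ _) p)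

  label-⋖ : ∀ {x y} → x ⋖ y → label y ≡ₘ suc (label x)
  label-⋖ {x} {y} x⋖y = begin
    label y                                       ≡⟨ label-via x∼y (leader-⋖ x⋖y) ⟩
    base (leader x) + offset x∼y                  ≈⟨ +-cong-≡ₘ ≡ₘ-refl (offset-stepʳ x⋖y (leader-∼ x)) ⟩
    base (leader x) + suc (offset (leader-∼ x))   ≡⟨ ℕ.+-suc (base (leader x)) _ ⟩
    suc (label x)                                 ∎
    where
      open ≡ₘ-Reasoning
      x∼y = ∼-stepʳ x⋖y (leader-∼ x)

  label-Dist : ∀ {n x y} → Dist n x y → label y ≡ₘ label x + n
  label-Dist {zero} refl = ≡⇒≡ₘ (sym (ℕ.+-identityʳ _))
  label-Dist {suc n} {x} {y} (w , x⋖w , w→y) = begin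
    label y             ≈⟨ label-Dist w→y ⟩
    label w + n         ≈⟨ +-cong-≡ₘ (label-⋖ x⋖w) ≡ₘ-refl ⟩
    suc (label x) + n   ≡⟨ ℕ.+-suc (label x) n ⟨
    label x + suc n     ∎
    where open ≡ₘ-Reasoning

  Covers : α → α → ℕ → ℕ → Set
  Covers x y r d = ∀ t → t ≤ d → ∃[ z ] x ⊑ z × z ⊑ y × label z ≡ₘ r + t

  Covers-widen : ∀ {x x′ y y′ r d} → x′ ⊑ x → y ⊑ y′ → Covers x y r d → Covers x′ y′ r d
  Covers-widen x′⊑x y⊑y′ cov t t≤d with cov t t≤d
  ... | z , x⊑z , z⊑y , lz = z , ⊑-trans x′⊑x x⊑z , ⊑-trans z⊑y y⊑y′ , lz

  Covers-≤ : ∀ {x y r d e} → e ≤ d → Covers x y r d → Covers x y r e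
  Covers-≤ e≤d cov t t≤e = cov t (ℕ.≤-trans t≤e e≤d)

  Covers-++ : ∀ {x y r r′ d e} → r′ ≡ₘ r + d → Covers x y r d → Covers x y r′ e → Covers x y r (d + e)
  Covers-++ {r = r} {r′} {d} r′≡r+d cov cov′ t t≤d+e with t ≤? d
  ... | yes t≤d = cov t t≤d
  ... | no t≰d with cov′ (t ∸ d) (ℕ.m≤n+o⇒m∸n≤o t d t≤d+e)
  ...   | z , x⊑z , z⊑y , lz = z , x⊑z , z⊑y , (begin
          label z                ≈⟨ lz ⟩
          r′ + (t ∸ d)           ≈⟨ +-cong-≡ₘ r′≡r+d ≡ₘ-refl ⟩
          r + d + (t ∸ d)        ≡⟨ ℕ.+-assoc r d (t ∸ d) ⟩
          r + (d + (t ∸ d))      ≡⟨ cong (r +_) (ℕ.m+[n∸m]≡n (ℕ.<⇒≤ (ℕ.≰⇒> t≰d))) ⟩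
          r + t                  ∎)
    where open ≡ₘ-Reasoning

  Dist-covers : ∀ {d x y} → Dist d x y → Covers x y (label x) d
  Dist-covers x→y t t≤d with Dist-prefix t≤d x→y
  ... | w , x→w , w⊑y = w , Dist⇒⊑ x→w , w⊑y , label-Dist x→w

  covers⇒allColours : ∀ {x y r} → Covers x y r k′ → AllColoursIn _⊏_ colour x y
  covers⇒allColours {r = r} cov j with residue-reachable r (toℕ j) (Fin.toℕ<n j)
  ... | t , t<K , r+t≡j with cov t (ℕ.≤-pred t<K)
  ...   | z , x⊑z , z⊑y , lz =
          z , x⊑z , z⊑y , Fin.toℕ-injective (trans (Fin.toℕ-fromℕ< _) (trans (residues lz) r+t≡j))

  module Gap (M N : α) (N-initial : ∀ p → ¬ p ⋖ N) where

    In : α → α → Set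
    In u w = u ⊏ w × w ⊏ N

    In-nonempty : ∀ {m} → m ⊏ N → ¬ m ⋖ N → ∃ (In m)
    In-nonempty {m} m⊏N ¬m⋖N with em (∃ (In m))
    ... | yes inhabited = inhabited
    ... | no ∄ = ⊥-elim (¬m⋖N (m⊏N , λ z m⊏z z⊏N → ∄ (z , m⊏z , z⊏N)))

    next : ∀ {u m} → Least (In u) m → ∃ (Least (In m))
    next {m = m} ((_ , m⊏N) , _) = least (proj₂ (In-nonempty m⊏N (N-initial m)))

    Step : α → α → Set
    Step m m′ = ∃[ d ] 0 < d × label m′ ≡ₘ label m + d × Covers m m′ (label m) d

    step : ∀ {u m m′} → Least (In u) m → Least (In m) m′ → Step m m′
    step {u} {m} {m′} ((u⊏m , _) , m-least) ((m⊏m′ , m′⊏N) , m′-least) with leader-⪯ m′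
    ... | inj₂ leader≡m′ = 1 , s≤s z≤n , label-m′ , covers
      where
        m≺m′ : m ≺ m′
        m≺m′ with ≺-compare m m′
        ... | tri< m≺m′ _ _ = m≺m′
        ... | tri≈ _ refl _ = ⊥-elim (⊏-irrefl m⊏m′)
        ... | tri> _ _ m′≺m = ⊥-elim (m-least m′ (⊏-trans u⊏m m⊏m′ , m′⊏N) m′≺m)
        anchor : Anchor m′ m
        anchor = m⊏m′ , m≺m′ ,
                 λ w w⊏m′ w≺m′ m⊏w → m′-least w (m⊏w , ⊏-trans w⊏m′ m′⊏N) w≺m′
        label-m′ : label m′ ≡ₘ label m + 1
        label-m′ = ≡⇒≡ₘ (begin
          label m′      ≡⟨ label-via ∼-refl leader≡m′ ⟩
          base m′ + 0   ≡⟨ ℕ.+-identityʳ _ ⟩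
          base m′       ≡⟨ base′-anchor (wf m′) anchor ⟩
          suc (label m) ≡⟨ ℕ.+-comm 1 (label m) ⟩
          label m + 1   ∎)
          where open ≡-Reasoning
        covers : Covers m m′ (label m) 1
        covers zero _ = m , ⊑-refl , inj₁ m⊏m′ , ≡⇒≡ₘ (sym (ℕ.+-identityʳ _))
        covers (suc zero) _ = m′ , inj₁ m⊏m′ , ⊑-refl , label-m′
        covers (suc (suc _)) (s≤s ())
    ... | inj₁ leader≺m′ = close (leader-∼ m′)
      where
        outside : ¬ In m (leader m′)
        outside m<l<N = m′-least (leader m′) m<l<N leader≺m′
        close : leader m′ ∼ m′ → Step m m′
        close (inj₁ (n , l→m′))
          with Dist-convex n l→m′
                 (¬⊐⇒⊑ λ m⊏l → outside (m⊏l , ⊑-⊏-trans (Dist⇒⊑ l→m′) m′⊏N)) (inj₁ m⊏m′)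
        ... | _ , (d , m→m′) = d , Dist-⊏⇒pos m→m′ m⊏m′ , label-Dist m→m′ , Dist-covers m→m′
        close (inj₂ (n , m′→l))
          with Dist-convex n m′→l
                 (inj₁ m′⊏N) (¬⊐⇒⊑ λ l⊏N → outside (⊏-⊑-trans m⊏m′ (Dist⇒⊑ m′→l) , l⊏N))
        ... | (_ , m′→N) , _ = ⊥-elim (N-initial _ (proj₂ (Dist-⊏⇒predecessor m′→N m′⊏N)))

    walk : ∀ T {u m} → M ⊑ u → Least (In u) m → Covers M N (label m) T
    walk zero M⊑u ((u⊏m , m⊏N) , _) =
      Covers-widen (inj₁ (⊑-⊏-trans M⊑u u⊏m)) (inj₁ m⊏N) (Dist-covers refl)
    walk (suc T) M⊑u lm@((u⊏m , _) , _) with next lm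
    ... | m′ , lm′@((_ , m′⊏N) , _) with step lm lm′
    ...   | d , 0<d , m′≡m+d , cov =
            Covers-≤ (ℕ.+-monoˡ-≤ T 0<d)
              (Covers-++ m′≡m+d (Covers-widen (inj₁ M⊏m) (inj₁ m′⊏N) cov) (walk T (inj₁ M⊏m) lm′))
      where M⊏m = ⊑-⊏-trans M⊑u u⊏m

    gap-covers : M ⊏ N → (∀ v → ¬ M ⋖ v) → ∃[ r ] Covers M N r k′
    gap-covers M⊏N M-final with least (proj₂ (In-nonempty M⊏N (M-final N)))
    ... | m , lm = label m , walk k′ ⊑-refl lm

  last-successor : ∀ {x} n → ¬ ∃ (Dist n x) → ∃[ M ] ∃ (λ j → Dist j x M) × (∀ v → ¬ M ⋖ v)
  last-successor zero ∄ = ⊥-elim (∄ (_ , refl))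
  last-successor {x} (suc n) ∄ with em (∃ (Dist n x))
  ... | yes (w , x→w) = w , (n , x→w) , λ v w⋖v → ∄ (v , Dist-snoc n x→w w⋖v)
  ... | no ∄′ = last-successor n ∄′

  first-predecessor : ∀ {y} n → ¬ ∃ (λ w → Dist n w y) →
                      ∃[ N ] ∃ (λ j → Dist j N y) × (∀ p → ¬ p ⋖ N)
  first-predecessor zero ∄ = ⊥-elim (∄ (_ , refl))
  first-predecessor {y} (suc n) ∄ with em (∃ λ w → Dist n w y)
  ... | yes (w , w→y) = w , (n , w→y) , λ p p⋖w → ∄ (p , w , p⋖w , w→y)
  ... | no ∄′ = first-predecessor n ∄′

  Dist-overlap : ∀ {i j x y M N} → x ⊏ y → Dist i x M → Dist j N y → N ⊑ M → ∃ λ n → Dist n x y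
  Dist-overlap {i} {j} {x} {N = N} x⊏y x→M N→y N⊑M with compare x N
  ... | tri< x⊏N _ _ = let (k , x→N) , _ = Dist-convex i x→M (inj₁ x⊏N) N⊑M
                       in k + j , Dist-trans k j x→N N→y
  ... | tri≈ _ x≡N _ = proj₂ (Dist-convex j N→y (inj₂ (sym x≡N)) (inj₁ x⊏y))
  ... | tri> _ _ N⊏x = proj₂ (Dist-convex j N→y (inj₁ N⊏x) (inj₁ x⊏y))

  gap-⊏ : ∀ {i j x y M N} → x ⊏ y → ¬ ∃ (λ n → Dist n x y) → Dist i x M → Dist j N y → M ⊏ N
  gap-⊏ {M = M} {N} x⊏y x↛y x→M N→y with compare M N
  ... | tri< M⊏N _ _ = M⊏N
  ... | tri≈ _ M≡N _ = ⊥-elim (x↛y (Dist-overlap x⊏y x→M N→y (inj₂ (sym M≡N))))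
  ... | tri> _ _ N⊏M = ⊥-elim (x↛y (Dist-overlap x⊏y x→M N→y (inj₁ N⊏M)))

  colour≡⇒label≡ₘ : ∀ {x y} → colour x ≡ colour y → label x ≡ₘ label y
  colour≡⇒label≡ₘ cx≡cy =
    mod (trans (sym (Fin.toℕ-fromℕ< _)) (trans (cong toℕ cx≡cy) (Fin.toℕ-fromℕ< _)))

  same-colour⇒far : ∀ {n x y} → Dist n x y → x ⊏ y → colour x ≡ colour y → k′ ≤ n
  same-colour⇒far {n} {x} x→y x⊏y cx≡cy with k′ ≤? n
  ... | yes k′≤n = k′≤n
  ... | no k′≰n
    with r+n≡ₘr⇒n≡0 (label x) (ℕ.m<n⇒m<1+n (ℕ.≰⇒> k′≰n))
           (≡ₘ-sym (≡ₘ-trans (colour≡⇒label≡ₘ cx≡cy) (label-Dist x→y)))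
  ...   | refl = ⊥-elim (ℕ.<-irrefl refl (Dist-⊏⇒pos x→y x⊏y))

  same-colour⇒allColours : ∀ {x y} → x ⊏ y → colour x ≡ colour y → AllColoursIn _⊏_ colour x y
  same-colour⇒allColours {x} {y} x⊏y cx≡cy with em (∃ λ n → Dist n x y)
  ... | yes (n , x→y) =
    covers⇒allColours (Covers-≤ (same-colour⇒far x→y x⊏y cx≡cy) (Dist-covers x→y))
  ... | no x↛y with em (∃ (Dist k′ x))
  ...   | yes (w , x→w) = covers⇒allColours (Covers-widen ⊑-refl w⊑y (Dist-covers x→w))
    where w⊑y = ¬⊐⇒⊑ λ y⊏w → x↛y (proj₁ (Dist-convex k′ x→w (inj₁ x⊏y) (inj₁ y⊏w)))
  ...   | no ∄x→ with em (∃ λ w → Dist k′ w y)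
  ...     | yes (w , w→y) = covers⇒allColours (Covers-widen x⊑w ⊑-refl (Dist-covers w→y))
    where x⊑w = ¬⊐⇒⊑ λ w⊏x → x↛y (proj₂ (Dist-convex k′ w→y (inj₁ w⊏x) (inj₁ x⊏y)))
  ...     | no ∄→y with last-successor k′ ∄x→ | first-predecessor k′ ∄→y
  ...       | M , (_ , x→M) , M-final | N , (_ , N→y) , N-initial
    with Gap.gap-covers M N N-initial (gap-⊏ x⊏y x↛y x→M N→y) M-final
  ... | _ , cov = covers⇒allColours (Covers-widen (Dist⇒⊑ x→M) (Dist⇒⊑ N→y) cov)

lemma2 : Classical →
         (α : Set) (_<_ : Rel α 0ℓ) → IsStrictTotalOrder _≡_ _<_ →
         (k : ℕ) → 1 ≤ k →
         Σ (α → Fin k) λ c →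
           (x y : α) → x < y → c x ≡ c y → AllColoursIn _<_ c x y
lemma2 (em , well-order) α _<_ sto (suc k′) _ with well-order α
... | _≺_ , wsto , wf = colour , λ _ _ → same-colour⇒allColours
  where open Colouring em sto wsto wf k′
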